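{- Let $n$ be a positive multiple of $4$ such that $l=n-1$ is squarefree, and let $W$ be a real $n\times n$ skew-symmetric matrix with zero diagonal, off-diagonal entries in $\{ -1,1\}$ and $WW^\top=(n-1)I$. Let $\mathcal{O}=\mathbf{Z}[\frac{1+\sqrt{ -l}}{2}]$ act on $\mathbf{R}^n$ via $(r+s\sqrt{ -l})\mathbf{v}=\mathbf{v}(rI+sW)$. Then the lattice $L_0=\{(a_1,\ldots,a_n)\in\mathbf{Z}^n: a_1+\cdots+a_n\equiv0\pmod 2\}$ is an $\mathcal{O}$-module (i.e. $\alpha\mathbf{v}\in L_0$ for all $\alpha\in\mathcal{O}$, $\mathbf{v}\in L_0$).
   Context: $\mathcal{O}$ is the ring of integers of $\mathbf{Q}(\sqrt{ -l})$; vectors are row vectors. -}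

module Defs where

open import Data.Nat as ℕ using (ℕ; zero; suc; _∸_)
open import Data.Nat.Divisibility as ℕD using ()
open import Data.Integer using (ℤ; +_; -_; _+_; _*_; 1ℤ; -1ℤ; 0ℤ)
open import Data.Integer.Divisibility using (_∣_)
open import Data.Fin as Fin using (Fin; zero; suc)
open import Relation.Nullary using (yes; no)
open import Data.Product using (Σ; _×_)
open import Data.Sum using (_⊎_)
open import Relation.Binary.PropositionalEquality using (_≡_; _≢_)

Σℤ : ∀ {n} → (Fin n → ℤ) → ℤ
Σℤ {zero}  f = 0ℤ
Σℤ {suc n} f = f zero + Σℤ (λ i → f (suc i))

Mat : ℕ → Set
Mat n = Fin n → Fin n → ℤ

Vecℤ : ℕ → Set
Vecℤ n = Fin n → ℤ

_·ᵥ_ : ∀ {n} → Vecℤ n → Mat n → Vecℤ n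
(v ·ᵥ W) j = Σℤ (λ i → v i * W i j)

WWᵀ : ∀ {n} → Mat n → Mat n
WWᵀ W i j = Σℤ (λ k → W i k * W j k)

Squarefree : ℕ → Set
Squarefree m = ∀ d → (d ℕ.* d) ℕD.∣ m → d ≡ 1

scalarId : ∀ {n} → ℤ → Mat n
scalarId c i j with i Fin.≟ j
... | yes _ = c
... | no  _ = 0ℤ

-- The hypotheses on W (entries of W lie in {-1,0,1}, hence W is an integer matrix).
record IsConferenceW (n : ℕ) (W : Mat n) : Set where
  field
    skew     : ∀ i j → W j i ≡ - W i j
    zeroDiag : ∀ i → W i i ≡ 0ℤ
    offDiag  : ∀ i j → i ≢ j → (W i j ≡ 1ℤ) ⊎ (W i j ≡ -1ℤ)
    orth     : ∀ i j → WWᵀ W i j ≡ scalarId (+ (n ∸ 1)) i j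

InL₀ : ∀ {n} → Vecℤ n → Set
InL₀ a = + 2 ∣ Σℤ a

-- O = ℤ[ω], ω = (1+√-l)/2.  An element α = x + yω (x,y ∈ ℤ) equals
-- (2x+y)/2 + (y/2)√-l, so it acts by v ↦ v((2x+y)/2 · I + (y/2) W), i.e.
-- 2(αv) = (2x+y) v + y (vW).
-- "αv ∈ L₀": there is an integer vector u ∈ L₀ with 2u = (2x+y)v + y(vW)
-- (u is then exactly the real vector αv).
ActInL₀ : ∀ {n} → Mat n → (x y : ℤ) → Vecℤ n → Set
ActInL₀ {n} W x y v =
  Σ (Vecℤ n) λ u → InL₀ u ×
    (∀ j → + 2 * u j ≡ (+ 2 * x + y) * v j + y * (v ·ᵥ W) j)

-- The generator ω = (1 + √-l)/2 of 𝒪 acts by v ↦ v(W + I)/2, and M = W + I is a ±1 matrix with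
-- MMᵀ = nI. Since every entry of M is odd, each coordinate of vM is ≡ Σᵢ vᵢ ≡ 0 (mod 2), so ωv is
-- integral. The coordinate sum of vM is Σᵢ vᵢρᵢ with ρᵢ the row sums of M. For odd a, b one has
-- a + b ≡ 1 + ab (mod 4), whence ρᵢ + ρⱼ ≡ n + (MMᵀ)ᵢⱼ ≡ 0 (mod 4); in particular ρ₁ is even, and
-- Σᵢ vᵢρᵢ ≡ -ρ₁ Σᵢ vᵢ ≡ 0 (mod 4). So ωv ∈ L₀, and then x v + y ωv ∈ L₀.
module Submission where

open import Defs
open import Data.Nat using (ℕ; _<_; _∸_)
open import Data.Nat.Divisibility using (_∣_)
open import Data.Integer using (ℤ)

open import Data.Nat using (zero; suc)
open import Data.Integer using (+_; -_; _+_; _-_; _*_; 0ℤ; 1ℤ; -1ℤ)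
open import Data.Integer.Properties using (+-comm; +-identityʳ; +-identityˡ; *-comm; *-zeroʳ; *-identityʳ; *-identityˡ; *-distribˡ-+; neg-distrib-+)
open import Data.Integer.Divisibility.Signed using (divides; quotient; ∣ᵤ⇒∣; ∣⇒∣ᵤ; ∣-trans; ∣m∣n⇒∣m+n; ∣m∣n⇒∣m-n; ∣n⇒∣m*n; *-monoʳ-∣; *-monoˡ-∣; *-cancelˡ-∣) renaming (_∣_ to _∣ℤ_)
open import Data.Integer.Tactic.RingSolver using (solve-∀)
open import Data.Fin using (Fin; zero; suc; _≟_)
open import Data.Fin.Properties using (suc-injective)
open import Data.Product using (_,_)
open import Data.Sum as Sum using (_⊎_; inj₁; inj₂)
open import Function using (_∘_)
open import Relation.Nullary using (yes; no; contradiction)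
open import Relation.Binary.PropositionalEquality using (_≡_; _≢_; refl; sym; trans; cong; cong₂; subst; module ≡-Reasoning)

private
  variable
    n : ℕ

Σℤ-cong : {f g : Fin n → ℤ} → (∀ i → f i ≡ g i) → Σℤ f ≡ Σℤ g
Σℤ-cong {zero}  f≡g = refl
Σℤ-cong {suc n} f≡g = cong₂ _+_ (f≡g zero) (Σℤ-cong (f≡g ∘ suc))

Σℤ-zero : (f : Fin n → ℤ) → (∀ i → f i ≡ 0ℤ) → Σℤ f ≡ 0ℤ
Σℤ-zero {zero}  f f≡0 = refl
Σℤ-zero {suc n} f f≡0 = cong₂ _+_ (f≡0 zero) (Σℤ-zero (f ∘ suc) (f≡0 ∘ suc))

Σℤ-+ : (f g : Fin n → ℤ) → Σℤ (λ i → f i + g i) ≡ Σℤ f + Σℤ g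
Σℤ-+ {zero}  f g = refl
Σℤ-+ {suc n} f g = trans (cong (_+_ (f zero + g zero)) (Σℤ-+ (f ∘ suc) (g ∘ suc)))
                         (interchange (f zero) (g zero) _ _)
  where
  interchange : ∀ a b c d → (a + b) + (c + d) ≡ (a + c) + (b + d)
  interchange = solve-∀

Σℤ-*ˡ : ∀ c (f : Fin n → ℤ) → Σℤ (λ i → c * f i) ≡ c * Σℤ f
Σℤ-*ˡ {zero}  c f = sym (*-zeroʳ c)
Σℤ-*ˡ {suc n} c f = trans (cong (_+_ (c * f zero)) (Σℤ-*ˡ c (f ∘ suc)))
                          (sym (*-distribˡ-+ c (f zero) _))

Σℤ-neg : (f : Fin n → ℤ) → Σℤ (λ i → - f i) ≡ - Σℤ f
Σℤ-neg {zero}  f = refl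
Σℤ-neg {suc n} f = trans (cong (_+_ (- f zero)) (Σℤ-neg (f ∘ suc)))
                         (sym (neg-distrib-+ (f zero) _))

Σℤ-1 : ∀ n → Σℤ {n} (λ _ → 1ℤ) ≡ + n
Σℤ-1 zero    = refl
Σℤ-1 (suc n) = cong (_+_ 1ℤ) (Σℤ-1 n)

Σℤ-swap : ∀ {m n} (f : Fin m → Fin n → ℤ) →
          Σℤ (λ j → Σℤ (λ i → f i j)) ≡ Σℤ (λ i → Σℤ (λ j → f i j))
Σℤ-swap {zero} {n} f = Σℤ-zero {n} (λ _ → 0ℤ) (λ _ → refl)
Σℤ-swap {suc m} f = trans (Σℤ-+ (f zero) (λ j → Σℤ (λ i → f (suc i) j)))
                          (cong (_+_ (Σℤ (f zero))) (Σℤ-swap (f ∘ suc)))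

Σℤ-single : (i : Fin n) (f : Fin n → ℤ) → (∀ k → k ≢ i → f k ≡ 0ℤ) → Σℤ f ≡ f i
Σℤ-single zero f vanish =
  trans (cong (_+_ (f zero)) (Σℤ-zero (f ∘ suc) (λ k → vanish (suc k) λ ()))) (+-identityʳ (f zero))
Σℤ-single (suc i) f vanish =
  trans (cong₂ _+_ (vanish zero λ ()) (Σℤ-single i (f ∘ suc) λ k k≢i → vanish (suc k) (k≢i ∘ suc-injective)))
        (+-identityˡ (f (suc i)))

∣-Σℤ : ∀ {d} {f : Fin n → ℤ} → (∀ i → d ∣ℤ f i) → d ∣ℤ Σℤ f
∣-Σℤ {zero}  d∣f = divides 0ℤ refl
∣-Σℤ {suc n} d∣f = ∣m∣n⇒∣m+n (d∣f zero) (∣-Σℤ (d∣f ∘ suc))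

*-pres-∣ : ∀ {a b c d} → a ∣ℤ b → c ∣ℤ d → a * c ∣ℤ b * d
*-pres-∣ {a} {b} {c} {d} a∣b c∣d = ∣-trans (*-monoʳ-∣ a c∣d) (*-monoˡ-∣ d a∣b)

δ : Mat n
δ = scalarId 1ℤ

scalarId-diag : ∀ c (i : Fin n) → scalarId c i i ≡ c
scalarId-diag c i with i ≟ i
... | yes _   = refl
... | no  i≢i = contradiction refl i≢i

scalarId-offdiag : ∀ c {i j : Fin n} → i ≢ j → scalarId c i j ≡ 0ℤ
scalarId-offdiag c {i} {j} i≢j with i ≟ j
... | yes i≡j = contradiction i≡j i≢j
... | no  _   = refl

scalarId≡*δ : ∀ c (i j : Fin n) → scalarId c i j ≡ c * δ i j
scalarId≡*δ c i j with i ≟ j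
... | yes _ = sym (*-identityʳ c)
... | no  _ = sym (*-zeroʳ c)

∣-scalarId : ∀ {d c} (i j : Fin n) → d ∣ℤ c → d ∣ℤ scalarId c i j
∣-scalarId i j d∣c with i ≟ j
... | yes _ = d∣c
... | no  _ = divides 0ℤ refl

Σℤ-*δ : (f : Fin n → ℤ) (j : Fin n) → Σℤ (λ k → f k * δ k j) ≡ f j
Σℤ-*δ f j = begin
  Σℤ (λ k → f k * δ k j) ≡⟨ Σℤ-single j _ (λ k k≢j → trans (cong (f k *_) (scalarId-offdiag 1ℤ k≢j)) (*-zeroʳ (f k))) ⟩
  f j * δ j j            ≡⟨ cong (f j *_) (scalarId-diag 1ℤ j) ⟩
  f j * 1ℤ               ≡⟨ *-identityʳ (f j) ⟩
  f j                    ∎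
  where open ≡-Reasoning

Σℤ-δ* : (i : Fin n) (f : Fin n → ℤ) → Σℤ (λ k → δ i k * f k) ≡ f i
Σℤ-δ* i f = begin
  Σℤ (λ k → δ i k * f k) ≡⟨ Σℤ-single i _ (λ k k≢i → cong (_* f k) (scalarId-offdiag 1ℤ (k≢i ∘ sym))) ⟩
  δ i i * f i            ≡⟨ cong (_* f i) (scalarId-diag 1ℤ i) ⟩
  1ℤ * f i               ≡⟨ *-identityˡ (f i) ⟩
  f i                    ∎
  where open ≡-Reasoning

_+I : Mat n → Mat n
(W +I) i j = W i j + δ i j

·ᵥ-+I : (v : Vecℤ n) (W : Mat n) (j : Fin n) → (v ·ᵥ (W +I)) j ≡ v j + (v ·ᵥ W) j
·ᵥ-+I v W j = begin
  Σℤ (λ i → v i * (W i j + δ i j))         ≡⟨ Σℤ-cong (λ i → *-distribˡ-+ (v i) (W i j) (δ i j)) ⟩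
  Σℤ (λ i → v i * W i j + v i * δ i j)     ≡⟨ Σℤ-+ (λ i → v i * W i j) (λ i → v i * δ i j) ⟩
  (v ·ᵥ W) j + Σℤ (λ i → v i * δ i j)      ≡⟨ cong (_+_ ((v ·ᵥ W) j)) (Σℤ-*δ v j) ⟩
  (v ·ᵥ W) j + v j                         ≡⟨ +-comm ((v ·ᵥ W) j) (v j) ⟩
  v j + (v ·ᵥ W) j                         ∎
  where open ≡-Reasoning

±1⇒odd : ∀ {a} → a ≡ 1ℤ ⊎ a ≡ -1ℤ → + 2 ∣ℤ a - 1ℤ
±1⇒odd (inj₁ refl) = divides 0ℤ refl
±1⇒odd (inj₂ refl) = divides -1ℤ refl

+I-±1 : ∀ {W : Mat n} → IsConferenceW n W → ∀ i j → (W +I) i j ≡ 1ℤ ⊎ (W +I) i j ≡ -1ℤ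
+I-±1 {W = W} conf i j with i ≟ j
... | yes refl = inj₁ (cong (_+ 1ℤ) (IsConferenceW.zeroDiag conf i))
... | no  i≢j  = Sum.map (trans (+-identityʳ (W i j))) (trans (+-identityʳ (W i j)))
                         (IsConferenceW.offDiag conf i j i≢j)

WWᵀ-+I : ∀ {n} {W : Mat n} → IsConferenceW n W → ∀ i j → WWᵀ (W +I) i j ≡ scalarId (+ n) i j
WWᵀ-+I {suc m} {W} conf i j = begin
  Σℤ (λ k → (W i k + δ i k) * (W j k + δ j k))
    ≡⟨ Σℤ-cong (λ k → expand (W i k) (W j k) (δ i k) (δ j k)) ⟩
  Σℤ (λ k → W i k * W j k + (δᵢWⱼ k + (δⱼWᵢ k + δⱼδᵢ k)))
    ≡⟨ Σℤ-+ (λ k → W i k * W j k) (λ k → δᵢWⱼ k + (δⱼWᵢ k + δⱼδᵢ k)) ⟩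
  WWᵀ W i j + Σℤ (λ k → δᵢWⱼ k + (δⱼWᵢ k + δⱼδᵢ k))
    ≡⟨ cong (_+_ (WWᵀ W i j)) (trans (Σℤ-+ δᵢWⱼ (λ k → δⱼWᵢ k + δⱼδᵢ k)) (cong (_+_ (Σℤ δᵢWⱼ)) (Σℤ-+ δⱼWᵢ δⱼδᵢ))) ⟩
  WWᵀ W i j + (Σℤ δᵢWⱼ + (Σℤ δⱼWᵢ + Σℤ δⱼδᵢ))
    ≡⟨ cong₂ _+_ (trans (orth i j) (scalarId≡*δ (+ m) i j))
                 (cong₂ _+_ (trans (Σℤ-δ* i (W j)) (skew i j)) (cong₂ _+_ (Σℤ-δ* j (W i)) (Σℤ-δ* j (δ i)))) ⟩
  + m * δ i j + (- W i j + (W i j + δ i j))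
    ≡⟨ collect (+ m) (W i j) (δ i j) ⟩
  + suc m * δ i j
    ≡⟨ sym (scalarId≡*δ (+ suc m) i j) ⟩
  scalarId (+ suc m) i j ∎
  where
  open ≡-Reasoning
  open IsConferenceW conf
  δᵢWⱼ δⱼWᵢ δⱼδᵢ : Fin (suc m) → ℤ
  δᵢWⱼ k = δ i k * W j k
  δⱼWᵢ k = δ j k * W i k
  δⱼδᵢ k = δ j k * δ i k
  expand : ∀ a b d e → (a + d) * (b + e) ≡ a * b + (d * b + (e * a + e * d))
  expand = solve-∀
  collect : ∀ c a d → c * d + (- a + (a + d)) ≡ (1ℤ + c) * d
  collect = solve-∀

rowSum : Mat n → Fin n → ℤ
rowSum M i = Σℤ (M i)

Σℤ-·ᵥ : (v : Vecℤ n) (M : Mat n) → Σℤ (v ·ᵥ M) ≡ Σℤ (λ i → v i * rowSum M i)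
Σℤ-·ᵥ v M = trans (Σℤ-swap (λ i j → v i * M i j)) (Σℤ-cong (λ i → Σℤ-*ˡ (v i) (M i)))

rowSum-+ : (M : Mat n) (i j : Fin n) →
           rowSum M i + rowSum M j ≡ (+ n + WWᵀ M i j) - Σℤ (λ k → (M i k - 1ℤ) * (M j k - 1ℤ))
rowSum-+ {n} M i j = begin
  Σℤ (M i) + Σℤ (M j)                        ≡⟨ sym (Σℤ-+ (M i) (M j)) ⟩
  Σℤ (λ k → M i k + M j k)                   ≡⟨ Σℤ-cong (λ k → sum≡1+product-defect (M i k) (M j k)) ⟩
  Σℤ (λ k → (1ℤ + M i k * M j k) - defect k) ≡⟨ Σℤ-+ (λ k → 1ℤ + M i k * M j k) (λ k → - defect k) ⟩
  Σℤ (λ k → 1ℤ + M i k * M j k) + Σℤ (λ k → - defect k)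
    ≡⟨ cong₂ _+_ (trans (Σℤ-+ (λ _ → 1ℤ) (λ k → M i k * M j k)) (cong (_+ WWᵀ M i j) (Σℤ-1 n))) (Σℤ-neg defect) ⟩
  (+ n + WWᵀ M i j) - Σℤ defect              ∎
  where
  open ≡-Reasoning
  defect : Fin n → ℤ
  defect k = (M i k - 1ℤ) * (M j k - 1ℤ)
  sum≡1+product-defect : ∀ a b → a + b ≡ (1ℤ + a * b) - (a - 1ℤ) * (b - 1ℤ)
  sum≡1+product-defect = solve-∀

module _ (M : Mat n) (odd : ∀ i j → + 2 ∣ℤ M i j - 1ℤ) where

  ·ᵥ-even : (v : Vecℤ n) → + 2 ∣ℤ Σℤ v → ∀ j → + 2 ∣ℤ (v ·ᵥ M) j
  ·ᵥ-even v 2∣Σv j = subst (+ 2 ∣ℤ_) (sym vM≡Σv+even)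
    (∣m∣n⇒∣m+n 2∣Σv (∣-Σℤ (λ i → ∣n⇒∣m*n (v i) (odd i j))))
    where
    split : ∀ a m → a * m ≡ a + a * (m - 1ℤ)
    split = solve-∀
    vM≡Σv+even : (v ·ᵥ M) j ≡ Σℤ v + Σℤ (λ i → v i * (M i j - 1ℤ))
    vM≡Σv+even = trans (Σℤ-cong (λ i → split (v i) (M i j))) (Σℤ-+ v (λ i → v i * (M i j - 1ℤ)))

  4∣rowSum-+ : + 4 ∣ℤ + n → (∀ i j → + 4 ∣ℤ WWᵀ M i j) → ∀ i j → + 4 ∣ℤ rowSum M i + rowSum M j
  4∣rowSum-+ 4∣n 4∣MMᵀ i j = subst (+ 4 ∣ℤ_) (sym (rowSum-+ M i j))
    (∣m∣n⇒∣m-n (∣m∣n⇒∣m+n 4∣n (4∣MMᵀ i j)) (∣-Σℤ (λ k → *-pres-∣ (odd i k) (odd j k))))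

4∣Σℤ-weighted : (ρ : Fin n → ℤ) → (∀ i j → + 4 ∣ℤ ρ i + ρ j) → Fin n →
                (v : Vecℤ n) → + 2 ∣ℤ Σℤ v → + 4 ∣ℤ Σℤ (λ i → v i * ρ i)
4∣Σℤ-weighted {n} ρ 4∣ρ+ρ i₀ v (divides q Σv≡q*2) = subst (+ 4 ∣ℤ_) (sym Σvρ≡)
  (∣m∣n⇒∣m-n (∣-Σℤ {f = centred} (λ i → ∣n⇒∣m*n (v i) (4∣ρ+ρ i i₀))) 4∣ρ₀Σv)
  where
  open ≡-Reasoning
  ρ₀ : ℤ
  ρ₀ = ρ i₀
  recentre : ∀ a r r₀ → a * r ≡ a * (r + r₀) + - (r₀ * a)
  recentre = solve-∀
  centred : Fin n → ℤ
  centred i = v i * (ρ i + ρ₀)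
  Σvρ≡ : Σℤ (λ i → v i * ρ i) ≡ Σℤ centred - ρ₀ * Σℤ v
  Σvρ≡ = begin
    Σℤ (λ i → v i * ρ i)                        ≡⟨ Σℤ-cong (λ i → recentre (v i) (ρ i) ρ₀) ⟩
    Σℤ (λ i → centred i + - (ρ₀ * v i))         ≡⟨ Σℤ-+ centred (λ i → - (ρ₀ * v i)) ⟩
    Σℤ centred + Σℤ (λ i → - (ρ₀ * v i))        ≡⟨ cong (_+_ (Σℤ centred)) (Σℤ-neg (λ i → ρ₀ * v i)) ⟩
    Σℤ centred - Σℤ (λ i → ρ₀ * v i)            ≡⟨ cong (λ t → Σℤ centred - t) (Σℤ-*ˡ ρ₀ v) ⟩
    Σℤ centred - ρ₀ * Σℤ v                      ∎
  double : ∀ r q → r * (q * + 2) ≡ q * (r + r)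
  double = solve-∀
  4∣ρ₀Σv : + 4 ∣ℤ ρ₀ * Σℤ v
  4∣ρ₀Σv = subst (+ 4 ∣ℤ_) (sym (trans (cong (ρ₀ *_) Σv≡q*2) (double ρ₀ q))) (∣n⇒∣m*n q (4∣ρ+ρ i₀ i₀))

ActInL₀-via-ω : (W : Mat n) (x y : ℤ) (v : Vecℤ n) → InL₀ v →
                (∀ j → + 2 ∣ℤ (v ·ᵥ (W +I)) j) → + 4 ∣ℤ Σℤ (v ·ᵥ (W +I)) → ActInL₀ W x y v
ActInL₀-via-ω {n} W x y v v∈L₀ 2∣vM 4∣ΣvM = u , ∣⇒∣ᵤ 2∣Σu , 2u≡
  where
  open ≡-Reasoning
  ωv : Vecℤ n
  ωv j = quotient (2∣vM j)
  2ωv≡ : ∀ j → + 2 * ωv j ≡ (v ·ᵥ (W +I)) j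
  2ωv≡ j = sym (trans (_∣ℤ_.equality (2∣vM j)) (*-comm (ωv j) (+ 2)))
  2∣Σωv : + 2 ∣ℤ Σℤ ωv
  2∣Σωv = *-cancelˡ-∣ (+ 2) (subst (+ 4 ∣ℤ_) (trans (sym (Σℤ-cong 2ωv≡)) (Σℤ-*ˡ (+ 2) ωv)) 4∣ΣvM)
  u : Vecℤ n
  u j = x * v j + y * ωv j
  2∣Σu : + 2 ∣ℤ Σℤ u
  2∣Σu = subst (+ 2 ∣ℤ_) (sym (trans (Σℤ-+ (λ j → x * v j) (λ j → y * ωv j)) (cong₂ _+_ (Σℤ-*ˡ x v) (Σℤ-*ˡ y ωv))))
    (∣m∣n⇒∣m+n (∣n⇒∣m*n x (∣ᵤ⇒∣ v∈L₀)) (∣n⇒∣m*n y 2∣Σωv))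
  distribute : ∀ x y a b → + 2 * (x * a + y * b) ≡ + 2 * x * a + y * (+ 2 * b)
  distribute = solve-∀
  collect : ∀ x y a b → + 2 * x * a + y * (a + b) ≡ (+ 2 * x + y) * a + y * b
  collect = solve-∀
  2u≡ : ∀ j → + 2 * u j ≡ (+ 2 * x + y) * v j + y * (v ·ᵥ W) j
  2u≡ j = begin
    + 2 * (x * v j + y * ωv j)             ≡⟨ distribute x y (v j) (ωv j) ⟩
    + 2 * x * v j + y * (+ 2 * ωv j)       ≡⟨ cong (λ t → + 2 * x * v j + y * t) (trans (2ωv≡ j) (·ᵥ-+I v W j)) ⟩
    + 2 * x * v j + y * (v j + (v ·ᵥ W) j) ≡⟨ collect x y (v j) ((v ·ᵥ W) j) ⟩
    (+ 2 * x + y) * v j + y * (v ·ᵥ W) j   ∎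

-- Squarefreeness of n - 1 only serves to make 𝒪 the full ring of integers.
lemma3p1 : (n : ℕ) → 0 < n → 4 ∣ n → Squarefree (n ∸ 1) →
    (W : Mat n) → IsConferenceW n W →
    (x y : ℤ) (v : Vecℤ n) → InL₀ v → ActInL₀ W x y v
lemma3p1 (suc m) _ 4∣n _ W conf x y v v∈L₀ =
  ActInL₀-via-ω W x y v v∈L₀ (·ᵥ-even M M-odd v 2∣Σv) 4∣ΣvM
  where
  M : Mat (suc m)
  M = W +I
  M-odd : ∀ i j → + 2 ∣ℤ M i j - 1ℤ
  M-odd i j = ±1⇒odd (+I-±1 conf i j)
  2∣Σv : + 2 ∣ℤ Σℤ v
  2∣Σv = ∣ᵤ⇒∣ v∈L₀
  4∣n' : + 4 ∣ℤ + suc m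
  4∣n' = ∣ᵤ⇒∣ 4∣n
  4∣MMᵀ : ∀ i j → + 4 ∣ℤ WWᵀ M i j
  4∣MMᵀ i j = subst (+ 4 ∣ℤ_) (sym (WWᵀ-+I conf i j)) (∣-scalarId i j 4∣n')
  4∣ΣvM : + 4 ∣ℤ Σℤ (v ·ᵥ M)
  4∣ΣvM = subst (+ 4 ∣ℤ_) (sym (Σℤ-·ᵥ v M))
    (4∣Σℤ-weighted (rowSum M) (4∣rowSum-+ M M-odd 4∣n' 4∣MMᵀ) zero v 2∣Σv)
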